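{- Let $c\geq0$ and $k\geq1$ be integers, let $G$ be a graph and let $G'$ be a $(\leq c)$-subdivision of $G$. If $G'$ has a $k$-queue layout using vertex ordering $\preceq$, then $G$ has a $\frac{2k}{2k-1}\big((2k)^{c+1}-1\big)$-queue layout using the ordering $\preceq$ restricted to $V(G)$.
   Context: A $(\leq c)$-subdivision of $G$ is a graph obtained from $G$ by replacing each edge by a path with at most $c$ internal (new) vertices, so that $V(G)\subseteq V(G')$. A $k$-queue layout of a graph $H$ consists of a linear ordering $\preceq$ of $V(H)$ and a partition $E_1,\dots,E_k$ of $E(H)$ such that no two edges $vw,xy$ in the same $E_i$ satisfy $v\prec x\prec y\prec w$. -}

module Defs where

open import Data.Nat using (ℕ; _≤_; _<_)
open import Data.Fin as Fin using (Fin)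
open import Data.List using (List; []; _∷_; _++_; length)
open import Data.List.Membership.Propositional using (_∈_)
open import Data.List.Relation.Unary.Unique.Propositional using (Unique)
open import Data.Product using (Σ; ∃; _×_)
open import Data.Sum using (_⊎_)
open import Relation.Nullary using (¬_)
open import Relation.Binary.PropositionalEquality using (_≡_; _≢_)
open import Function.Definitions using (Injective)

record Graph : Set₁ where
  field
    n        : ℕ
    E        : Fin n → Fin n → Set
    E-sym    : ∀ {u v} → E u v → E v u
    E-irrefl : ∀ {u} → ¬ E u u
open Graph public

data Consecutive {A : Set} (a b : A) : List A → Set where
  here  : ∀ {xs} → Consecutive a b (a ∷ b ∷ xs)
  there : ∀ {x xs} → Consecutive a b xs → Consecutive a b (x ∷ xs)

-- G' is a (≤ c)-subdivision of G, where ι : V(G) → V(G') is the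
-- (injective) identification of V(G) with a subset of V(G').
-- Each edge uv of G (taken with canonical orientation u < v in Fin) is
-- replaced by the path  ι u , path u v , ι v  whose internal vertices
-- (the list path u v, at most c of them) are new, distinct, and not shared
-- with other edges' paths.  V(G') consists of V(G) and these internal
-- vertices, and E(G') is exactly the set of edges of these paths.
record IsSubdivision (c : ℕ) (G G' : Graph) (ι : Fin (n G) → Fin (n G')) : Set where
  field
    ι-inj         : Injective _≡_ _≡_ ι
    path          : Fin (n G) → Fin (n G) → List (Fin (n G'))
    path-length   : ∀ u v → u Fin.< v → E G u v → length (path u v) ≤ c
    path-unique   : ∀ u v → u Fin.< v → E G u v → Unique (path u v)
    path-new      : ∀ u v → u Fin.< v → E G u v →
                    ∀ {x} → x ∈ path u v → ∀ w → ι w ≢ x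
    path-disjoint : ∀ u v u' v' → u Fin.< v → E G u v → u' Fin.< v' → E G u' v' →
                    ∀ {x} → x ∈ path u v → x ∈ path u' v' → (u ≡ u' × v ≡ v')
    covers        : ∀ x → (∃ λ w → ι w ≡ x)
                          ⊎ (∃ λ u → ∃ λ v → u Fin.< v × E G u v × x ∈ path u v)
    edges-sound   : ∀ a b → E G' a b →
                    ∃ λ u → ∃ λ v → u Fin.< v × E G u v ×
                      (Consecutive a b (ι u ∷ path u v ++ ι v ∷ [])
                       ⊎ Consecutive b a (ι u ∷ path u v ++ ι v ∷ []))
    edges-complete : ∀ u v → u Fin.< v → E G u v → ∀ a b →
                     Consecutive a b (ι u ∷ path u v ++ ι v ∷ []) → E G' a b

-- A k-queue layout of H using the vertex ordering given by rank
-- (x ≺ y  iff  rank x < rank y; rank injective, so this is a linear order).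
-- queue assigns each edge to one of k queues (a partition of E(H)); no two
-- edges vw, xy in the same queue nest: v ≺ x ≺ y ≺ w.
record HasQueueLayout (H : Graph) (k : ℕ) (rank : Fin (n H) → ℕ) : Set where
  field
    rank-inj  : Injective _≡_ _≡_ rank
    queue     : Fin (n H) → Fin (n H) → Fin k
    queue-sym : ∀ u v → E H u v → queue u v ≡ queue v u
    no-nest   : ∀ v w x y → E H v w → E H x y → queue v w ≡ queue x y →
                ¬ (rank v < rank x × rank x < rank y × rank y < rank w)

module Submission where

-- Walk along the subdivided path of an edge of G and record,
-- for every edge of G' on it, its label: whether it goes forwards or backwards in
-- the vertex order, and its queue.  The key fact (walks-preserve-order) is that two
-- vertex-disjoint walks in a queue layout carrying the same label sequence keep
-- their relative order: if the first starts left of the second, it also ends left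
-- of it, since otherwise some step would create two nesting edges in one queue.
-- Two nested edges vw, xy of G (v ≺ x ≺ y ≺ w) have disjoint subdivided paths, and
-- however these are oriented the order of the start points is opposite to the
-- order of the end points (Nesting.opposite), so their label sequences differ.
-- Hence colouring an edge of G by its label sequence is a queue layout of G.
-- There are 2k labels and the sequences have length 1, …, c + 1, so there are
-- q = 2k + (2k)² + … + (2k)^(c+1) colours; the module Numeral encodes such
-- sequences injectively as numbers in [1, q] (bijective base-2k numerals).

open import Defs
open import Data.Bool using (Bool; true; false; T)
open import Data.Empty using (⊥; ⊥-elim)
open import Data.Fin as F using (Fin; zero; suc; toℕ; combine)
open import Data.Fin.Properties as FinP using (toℕ-injective; toℕ<n; toℕ-fromℕ<; combine-injective)
open import Data.List using (List; []; _∷_; _++_; length; map)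
open import Data.List.Properties using (∷-injective; length-++; length-map; map-injective)
open import Data.List.Membership.Propositional using (_∈_)
open import Data.List.Membership.Propositional.Properties using (∈-++⁻)
open import Data.List.Relation.Unary.Any using (here; there)
open import Data.List.Relation.Binary.Disjoint.Propositional using (Disjoint)
open import Data.List.Relation.Binary.Disjoint.Propositional.Properties using () renaming (sym to Disjoint-sym)
open import Data.Nat using (ℕ; suc; _+_; _*_; _∸_; _^_; _≤_; _<_; _<ᵇ_; z≤n; s≤s; NonZero; >-nonZero)
open import Data.Nat.DivMod using (_%_; _mod_; m<n⇒m%n≡m; [m+kn]%n≡m%n)
open import Data.Nat.Properties
open import Data.Nat.Tactic.RingSolver using (solve-∀)
open import Data.Product using (∃; ∃₂; _×_; _,_; proj₁; proj₂)
open import Data.Sum using (_⊎_; inj₁; inj₂; swap)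
open import Function using (_∘_)
open import Relation.Binary using (tri<; tri≈; tri>)
open import Relation.Binary.PropositionalEquality
open import Relation.Nullary using (¬_)

lastOf : {A : Set} → A → List A → A
lastOf x []       = x
lastOf x (y ∷ ys) = lastOf y ys

lastOf-∷ʳ : {A : Set} (x : A) (ys : List A) (z : A) → lastOf x (ys ++ z ∷ []) ≡ z
lastOf-∷ʳ x []       z = refl
lastOf-∷ʳ x (y ∷ ys) z = lastOf-∷ʳ y ys z

IsWalk : (H : Graph) → List (Fin (n H)) → Set
IsWalk H xs = ∀ {a b} → Consecutive a b xs → E H a b

bit : Bool → Fin 2
bit false = zero
bit true  = suc zero

bit-injective : ∀ {x y} → bit x ≡ bit y → x ≡ y
bit-injective {false} {false} _ = refl
bit-injective {true}  {true}  _ = refl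

module LayoutWalks {H : Graph} {k : ℕ} {rank : Fin (n H) → ℕ} (L : HasQueueLayout H k rank) where
  open HasQueueLayout L

  Label : Set
  Label = Bool × Fin k

  label : Fin (n H) → Fin (n H) → Label
  label a b = ((rank a <ᵇ rank b) , queue a b)

  labels : Fin (n H) → List (Fin (n H)) → List Label
  labels p []       = []
  labels p (x ∷ xs) = label p x ∷ labels x xs

  length-labels : ∀ p xs → length (labels p xs) ≡ length xs
  length-labels p []       = refl
  length-labels p (x ∷ xs) = cong suc (length-labels x xs)

  digit : Label → Fin (2 * k)
  digit (d , i) = combine (bit d) i

  digit-injective : ∀ {l l'} → digit l ≡ digit l' → l ≡ l'
  digit-injective {d , i} {d' , i'} eq =
    let (bits , queues) = combine-injective (bit d) i (bit d') i' eq
    in cong₂ _,_ (bit-injective bits) queues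

  edge-ranks-differ : ∀ {a b} → E H a b → rank a ≢ rank b
  edge-ranks-differ {a} e eq = E-irrefl H (subst (E H a) (sym (rank-inj eq)) e)

  backwards-together : ∀ {p p' q q'} → E H p p' → (rank p <ᵇ rank p') ≡ (rank q <ᵇ rank q') →
                       rank q' < rank q → rank p' < rank p
  backwards-together {p} {p'} e same q'<q with <-cmp (rank p) (rank p')
  ... | tri< p<p' _ _ = ⊥-elim (<-asym q'<q (<ᵇ⇒< _ _ (subst T same (<⇒<ᵇ p<p'))))
  ... | tri≈ _ eq _   = ⊥-elim (edge-ranks-differ e eq)
  ... | tri> _ _ p'<p = p'<p

  -- One step: equally labelled edges pp', qq' with p ≺ q and p' ≠ q' satisfy
  -- p' ≺ q'; otherwise pp' nests over qq' (forwards) or qq' over pp' (backwards).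
  step-preserves-order : ∀ {p p' q q'} → E H p p' → E H q q' → p' ≢ q' →
                         label p p' ≡ label q q' → rank p < rank q → rank p' < rank q'
  step-preserves-order {p} {p'} {q} {q'} Ep Eq p'≢q' same p<q with <-cmp (rank p') (rank q')
  ... | tri< p'<q' _ _ = p'<q'
  ... | tri≈ _ eq _    = ⊥-elim (p'≢q' (rank-inj eq))
  ... | tri> _ _ q'<p' with <-cmp (rank q) (rank q')
  ...   | tri< q<q' _ _ = ⊥-elim (no-nest p p' q q' Ep Eq (cong proj₂ same) (p<q , q<q' , q'<p'))
  ...   | tri≈ _ eq _   = ⊥-elim (edge-ranks-differ Eq eq)
  ...   | tri> _ _ q'<q = ⊥-elim (no-nest q' q p' p (E-sym H Eq) (E-sym H Ep) reversed-queues
                                     (q'<p' , backwards-together Ep (cong proj₁ same) q'<q , p<q))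
    where
      reversed-queues : queue q' q ≡ queue p' p
      reversed-queues = trans (sym (queue-sym q q' Eq))
                          (trans (sym (cong proj₂ same)) (queue-sym p p' Ep))

  walks-preserve-order : ∀ p xs q ys → IsWalk H (p ∷ xs) → IsWalk H (q ∷ ys) →
                         labels p xs ≡ labels q ys → Disjoint (p ∷ xs) (q ∷ ys) →
                         rank p < rank q → rank (lastOf p xs) < rank (lastOf q ys)
  walks-preserve-order p []       q []       _  _  _    _    p<q = p<q
  walks-preserve-order p []       q (_ ∷ _)  _  _  ()   _    _
  walks-preserve-order p (_ ∷ _)  q []       _  _  ()   _    _
  walks-preserve-order p (x ∷ xs) q (y ∷ ys) wp wq same disj p<q =
    walks-preserve-order x xs y ys (wp ∘ there) (wq ∘ there) (proj₂ (∷-injective same))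
      (λ (m , m') → disj (there m , there m'))
      (step-preserves-order (wp here) (wq here) (λ x≡y → disj (there (here refl) , there (here x≡y)))
        (proj₁ (∷-injective same)) p<q)

-- Bijective base-(b+1) numerals: a word d₀ d₁ … d_{m-1} over the digits
-- 0, …, b is encoded as Σ (dᵢ + 1) (b+1)ⁱ.
module Numeral (b : ℕ) where

  code : List (Fin (suc b)) → ℕ
  code []       = 0
  code (d ∷ ds) = suc (toℕ d + code ds * suc b)

  digit-split : ∀ (d d' : Fin (suc b)) x y → toℕ d + x * suc b ≡ toℕ d' + y * suc b →
                d ≡ d' × x ≡ y
  digit-split d d' x y eq = d≡d' ,
      *-cancelʳ-≡ x y (suc b) (+-cancelˡ-≡ (toℕ d) _ _ (trans eq (cong (λ e → toℕ e + y * suc b) (sym d≡d'))))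
    where
      remainder : ∀ (e : Fin (suc b)) z → (toℕ e + z * suc b) % suc b ≡ toℕ e
      remainder e z = trans ([m+kn]%n≡m%n (toℕ e) z (suc b)) (m<n⇒m%n≡m (toℕ<n e))
      d≡d' : d ≡ d'
      d≡d' = toℕ-injective (trans (sym (remainder d x)) (trans (cong (_% suc b) eq) (remainder d' y)))

  code-injective : ∀ ds ds' → code ds ≡ code ds' → ds ≡ ds'
  code-injective []       []         _  = refl
  code-injective (d ∷ ds) (d' ∷ ds') eq =
    let (d≡d' , rest) = digit-split d d' (code ds) (code ds') (suc-injective eq)
    in cong₂ _∷_ d≡d' (code-injective ds ds' rest)

  code-positive : ∀ ds → 1 ≤ length ds → 1 ≤ code ds
  code-positive (_ ∷ _) _ = s≤s z≤n

  code-bound : ∀ ds → code ds * b + suc b ≤ suc b ^ suc (length ds)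
  code-bound []       = ≤-reflexive (sym (*-identityʳ (suc b)))
  code-bound (d ∷ ds) = begin
      (suc (toℕ d) + code ds * suc b) * b + suc b
        ≤⟨ +-monoˡ-≤ (suc b) (*-monoˡ-≤ b (+-monoˡ-≤ (code ds * suc b) (toℕ<n d))) ⟩
      (suc b + code ds * suc b) * b + suc b         ≡⟨ regroup b (code ds) ⟩
      suc b * (code ds * b + suc b)                 ≤⟨ *-monoʳ-≤ (suc b) (code-bound ds) ⟩
      suc b * suc b ^ suc (length ds)               ∎
    where
      open ≤-Reasoning
      regroup : ∀ b x → (suc b + x * suc b) * b + suc b ≡ suc b * (x * b + suc b)
      regroup = solve-∀

  code-≤ : ∀ {q c} .{{_ : NonZero b}} → q * b ≡ suc b * (suc b ^ c ∸ 1) →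
           ∀ ds → length ds ≤ c → code ds ≤ q
  code-≤ {q} {c} q-spec ds len≤c = *-cancelʳ-≤ (code ds) q b (begin
      code ds * b                        ≤⟨ m+n≤o⇒m≤o∸n (code ds * b) (code-bound ds) ⟩
      suc b ^ suc (length ds) ∸ suc b    ≤⟨ ∸-monoˡ-≤ (suc b) (^-monoʳ-≤ (suc b) (s≤s len≤c)) ⟩
      suc b * suc b ^ c ∸ suc b          ≡⟨ cong (suc b * suc b ^ c ∸_) (sym (*-identityʳ (suc b))) ⟩
      suc b * suc b ^ c ∸ suc b * 1      ≡⟨ sym (*-distribˡ-∸ (suc b) (suc b ^ c) 1) ⟩
      suc b * (suc b ^ c ∸ 1)            ≡⟨ sym q-spec ⟩
      q * b                              ∎)
    where open ≤-Reasoning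

Endpoint : {A : Set} → A → A → A → Set
Endpoint u s t = u ≡ s ⊎ u ≡ t

Orientation : {A : Set} → A → A → A → A → Set
Orientation s t v w = (s ≡ v × t ≡ w) ⊎ (s ≡ w × t ≡ v)

orientation-endpoint : {A : Set} {u s t v w : A} → Orientation s t v w → Endpoint u s t → Endpoint u v w
orientation-endpoint (inj₁ (refl , refl)) = λ eu → eu
orientation-endpoint (inj₂ (refl , refl)) = swap

orientation-edge : (G : Graph) {s t v w : Fin (n G)} → Orientation s t v w → E G v w → E G s t
orientation-edge G (inj₁ (refl , refl)) e = e
orientation-edge G (inj₂ (refl , refl)) e = E-sym G e

module SubdivisionRoutes {c : ℕ} {G G' : Graph} {ι : Fin (n G) → Fin (n G')}
                         (S : IsSubdivision c G G' ι) where
  open IsSubdivision S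

  route : Fin (n G) → Fin (n G) → List (Fin (n G'))
  route s t = path s t ++ ι t ∷ []

  route-walk : ∀ {s t} → s F.< t → E G s t → IsWalk G' (ι s ∷ route s t)
  route-walk s<t e = edges-complete _ _ s<t e _ _

  route-last : ∀ s t → lastOf (ι s) (route s t) ≡ ι t
  route-last s t = lastOf-∷ʳ (ι s) (path s t) (ι t)

  route-length : ∀ {s t} → s F.< t → E G s t → 1 ≤ length (route s t) × length (route s t) ≤ suc c
  route-length {s} {t} s<t e rewrite length-++ (path s t) {ι t ∷ []} | +-comm (length (path s t)) 1 =
    s≤s z≤n , s≤s (path-length s t s<t e)

  route-vertex : ∀ {s t x} → x ∈ ι s ∷ route s t →
                 (∃ λ u → Endpoint u s t × x ≡ ι u) ⊎ x ∈ path s t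
  route-vertex {s} (here x≡) = inj₁ (s , inj₁ refl , x≡)
  route-vertex {s} {t} (there m) with ∈-++⁻ (path s t) m
  ... | inj₁ m'        = inj₂ m'
  ... | inj₂ (here x≡) = inj₁ (t , inj₂ refl , x≡)

  routes-disjoint : ∀ {s t s' t'} → s F.< t → E G s t → s' F.< t' → E G s' t' →
                    (∀ {u u'} → Endpoint u s t → Endpoint u' s' t' → u ≢ u') →
                    Disjoint (ι s ∷ route s t) (ι s' ∷ route s' t')
  routes-disjoint s<t e s'<t' e' separated (m , m') with route-vertex m | route-vertex m'
  ... | inj₁ (u , eu , x≡) | inj₁ (u' , eu' , x≡') = separated eu eu' (ι-inj (trans (sym x≡) x≡'))
  ... | inj₁ (u , _ , x≡)  | inj₂ p'               = path-new _ _ s'<t' e' p' u (sym x≡)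
  ... | inj₂ p             | inj₁ (u' , _ , x≡')   = path-new _ _ s<t e p u' (sym x≡')
  ... | inj₂ p             | inj₂ p'               =
    separated (inj₁ refl) (inj₁ refl) (proj₁ (path-disjoint _ _ _ _ s<t e s'<t' e' p p'))

orient : ∀ {m} → Fin m → Fin m → Fin m × Fin m
orient a a' with FinP.<-cmp a a'
... | tri< _ _ _ = a , a'
... | tri≈ _ _ _ = a , a'
... | tri> _ _ _ = a' , a

orient-sym : ∀ {m} {a a' : Fin m} → a ≢ a' → orient a a' ≡ orient a' a
orient-sym {a = a} {a'} a≢a' with FinP.<-cmp a a' | FinP.<-cmp a' a
... | tri< _ _ _ | tri> _ _ _ = refl
... | tri> _ _ _ | tri< _ _ _ = refl
... | tri< x _ _ | tri< y _ _ = ⊥-elim (FinP.<-asym x y)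
... | tri> _ _ x | tri> _ _ y = ⊥-elim (FinP.<-asym x y)
... | tri≈ _ e _ | _          = ⊥-elim (a≢a' e)
... | _          | tri≈ _ e _ = ⊥-elim (a≢a' (sym e))

orient-view : ∀ {m} {a a' : Fin m} → a ≢ a' →
              ∃₂ λ s t → orient a a' ≡ (s , t) × s F.< t × Orientation s t a a'
orient-view {a = a} {a'} a≢a' with FinP.<-cmp a a'
... | tri< a<a' _ _ = a , a' , refl , a<a' , inj₁ (refl , refl)
... | tri≈ _ e _    = ⊥-elim (a≢a' e)
... | tri> _ _ a'<a = a' , a , refl , a'<a , inj₂ (refl , refl)

module Nesting {A : Set} (r : A → ℕ) {v w x y : A} (nested : r v < r x × r x < r y × r y < r w) where
  private
    v<x = proj₁ nested
    x<y = proj₁ (proj₂ nested)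
    y<w = proj₂ (proj₂ nested)

  separated : ∀ {u u'} → Endpoint u v w → Endpoint u' x y → u ≢ u'
  separated eu eu' u≡u' = ranks-differ eu eu' (cong r u≡u')
    where
      ranks-differ : ∀ {u u'} → Endpoint u v w → Endpoint u' x y → r u ≢ r u'
      ranks-differ (inj₁ refl) (inj₁ refl) = <⇒≢ v<x
      ranks-differ (inj₁ refl) (inj₂ refl) = <⇒≢ (<-trans v<x x<y)
      ranks-differ (inj₂ refl) (inj₁ refl) = ≢-sym (<⇒≢ (<-trans x<y y<w))
      ranks-differ (inj₂ refl) (inj₂ refl) = ≢-sym (<⇒≢ y<w)

  opposite : ∀ {s t s' t'} → Orientation s t v w → Orientation s' t' x y →
             (r s < r s' × r t' < r t) ⊎ (r s' < r s × r t < r t')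
  opposite (inj₁ (refl , refl)) (inj₁ (refl , refl)) = inj₁ (v<x , y<w)
  opposite (inj₁ (refl , refl)) (inj₂ (refl , refl)) = inj₁ (<-trans v<x x<y , <-trans x<y y<w)
  opposite (inj₂ (refl , refl)) (inj₁ (refl , refl)) = inj₂ (<-trans x<y y<w , <-trans v<x x<y)
  opposite (inj₂ (refl , refl)) (inj₂ (refl , refl)) = inj₂ (y<w , v<x)

module Construction (c k′ : ℕ) (G G' : Graph) (ι : Fin (n G) → Fin (n G'))
                    (S : IsSubdivision c G G' ι) (rank : Fin (n G') → ℕ)
                    (L : HasQueueLayout G' (suc k′) rank) (q : ℕ)
                    (q-spec : q * (2 * suc k′ ∸ 1) ≡ 2 * suc k′ * ((2 * suc k′) ^ suc c ∸ 1)) where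
  open IsSubdivision S using (ι-inj)
  open HasQueueLayout L using (rank-inj)
  open LayoutWalks L
  open SubdivisionRoutes S
  open Numeral (2 * suc k′ ∸ 1)

  r : Fin (n G) → ℕ
  r = rank ∘ ι

  instance
    base-nonzero : NonZero (2 * suc k′ ∸ 1)
    base-nonzero = >-nonZero (≤-trans (s≤s z≤n) (m≤n+m (suc (k′ + 0)) k′))

  word : Fin (n G) × Fin (n G) → List (Fin (2 * suc k′))
  word (s , t) = map digit (labels (ι s) (route s t))

  word-code-range : ∀ {s t} → s F.< t → E G s t → 1 ≤ code (word (s , t)) × code (word (s , t)) ≤ q
  word-code-range {s} {t} s<t e =
      code-positive (word (s , t)) (subst (1 ≤_) (sym len) (proj₁ bounds)) ,
      code-≤ {c = suc c} q-spec (word (s , t)) (subst (_≤ suc c) (sym len) (proj₂ bounds))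
    where
      bounds : 1 ≤ length (route s t) × length (route s t) ≤ suc c
      bounds = route-length s<t e
      len : length (word (s , t)) ≡ length (route s t)
      len = trans (length-map digit (labels (ι s) (route s t))) (length-labels (ι s) (route s t))

  q-positive : 1 ≤ q
  q-positive = code-≤ {c = suc c} q-spec (zero ∷ []) (s≤s z≤n)

  instance
    q-nonzero : NonZero q
    q-nonzero = >-nonZero q-positive

  edge-distinct : ∀ {a a'} → E G a a' → a ≢ a'
  edge-distinct {a} e eq = E-irrefl G (subst (E G a) (sym eq) e)

  edge-view : ∀ {a a'} → E G a a' →
              ∃₂ λ s t → orient a a' ≡ (s , t) × s F.< t × E G s t × Orientation s t a a'
  edge-view e with orient-view (edge-distinct e)
  ... | s , t , eq , s<t , o = s , t , eq , s<t , orientation-edge G o e , o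

  index : Fin (n G) → Fin (n G) → ℕ
  index a a' = code (word (orient a a')) ∸ 1

  color : Fin (n G) → Fin (n G) → Fin q
  color a a' = index a a' mod q

  edge-code-range : ∀ {a a'} → E G a a' → 1 ≤ code (word (orient a a')) × code (word (orient a a')) ≤ q
  edge-code-range e with edge-view e
  ... | s , t , eq , s<t , Est , _ rewrite eq = word-code-range s<t Est

  index<q : ∀ {a a'} → E G a a' → index a a' < q
  index<q e = shift (edge-code-range e)
    where
      shift : ∀ {m} → 1 ≤ m × m ≤ q → m ∸ 1 < q
      shift {suc m} (_ , m<q) = m<q

  toℕ-color : ∀ {a a'} → E G a a' → toℕ (color a a') ≡ index a a'
  toℕ-color e = trans (toℕ-fromℕ< _) (m<n⇒m%n≡m (index<q e))

  same-color⇒same-word : ∀ {v w x y} → E G v w → E G x y → color v w ≡ color x y →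
                         word (orient v w) ≡ word (orient x y)
  same-color⇒same-word Evw Exy same =
    code-injective _ _ (∸-cancelʳ-≡ (proj₁ (edge-code-range Evw)) (proj₁ (edge-code-range Exy))
      (trans (sym (toℕ-color Evw)) (trans (cong toℕ same) (toℕ-color Exy))))

  routes-order : ∀ {s t s' t'} → s F.< t → E G s t → s' F.< t' → E G s' t' →
                 labels (ι s) (route s t) ≡ labels (ι s') (route s' t') →
                 Disjoint (ι s ∷ route s t) (ι s' ∷ route s' t') → r s < r s' → r t < r t'
  routes-order {s} {t} {s'} {t'} s<t Est s'<t' Es't' same disjoint s<s' =
    subst₂ (λ a b → rank a < rank b) (route-last s t) (route-last s' t')
      (walks-preserve-order (ι s) (route s t) (ι s') (route s' t')
        (route-walk s<t Est) (route-walk s'<t' Es't') same disjoint s<s')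

  nested-words-differ : ∀ {v w x y s t s' t'} → r v < r x × r x < r y × r y < r w →
                        s F.< t → E G s t → Orientation s t v w →
                        s' F.< t' → E G s' t' → Orientation s' t' x y →
                        word (s , t) ≢ word (s' , t')
  nested-words-differ {s = s} {t} {s'} {t'} nested s<t Est o s'<t' Es't' o' same-word = refute (opposite o o')
    where
      open Nesting r nested
      same-labels : labels (ι s) (route s t) ≡ labels (ι s') (route s' t')
      same-labels = map-injective digit-injective same-word
      disjoint : Disjoint (ι s ∷ route s t) (ι s' ∷ route s' t')
      disjoint = routes-disjoint s<t Est s'<t' Es't'
        (λ eu eu' → separated (orientation-endpoint o eu) (orientation-endpoint o' eu'))
      refute : (r s < r s' × r t' < r t) ⊎ (r s' < r s × r t < r t') → ⊥
      refute (inj₁ (s<s' , t'<t)) =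
        <-asym t'<t (routes-order s<t Est s'<t' Es't' same-labels disjoint s<s')
      refute (inj₂ (s'<s , t<t')) =
        <-asym t<t' (routes-order s'<t' Es't' s<t Est (sym same-labels) (Disjoint-sym disjoint) s'<s)

  no-nest : ∀ v w x y → E G v w → E G x y → color v w ≡ color x y →
            ¬ (r v < r x × r x < r y × r y < r w)
  no-nest v w x y Evw Exy same nested =
    let (s  , t  , o≡  , s<t   , Est   , o)  = edge-view Evw
        (s' , t' , o≡' , s'<t' , Es't' , o') = edge-view Exy
    in nested-words-differ nested s<t Est o s'<t' Es't' o'
         (subst₂ (λ P Q → word P ≡ word Q) o≡ o≡' (same-color⇒same-word Evw Exy same))

  layout : HasQueueLayout G q r
  layout = record
    { rank-inj  = λ eq → ι-inj (rank-inj eq)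
    ; queue     = color
    ; queue-sym = λ a a' e → cong (λ o → (code (word o) ∸ 1) mod q) (orient-sym (edge-distinct e))
    ; no-nest   = no-nest
    }

lemma11 : (c k : ℕ) → 1 ≤ k → (G G' : Graph) → (ι : Fin (n G) → Fin (n G')) →
          IsSubdivision c G G' ι →
          (rank : Fin (n G') → ℕ) → HasQueueLayout G' k rank →
          (q : ℕ) → q * (2 * k ∸ 1) ≡ 2 * k * ((2 * k) ^ suc c ∸ 1) →
          HasQueueLayout G q (rank ∘ ι)
lemma11 c (suc k′) _ G G' ι S rank L q q-spec = Construction.layout c k′ G G' ι S rank L q q-spec
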